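{- Let $n,m\in\mathbb{N}$ and let $X,Y\in\mathcal{IS}(n,m)$. If $X \simeq_{\mathrm{sa}} Y$, then there exists an $l\in\mathbb{N}$ such that for all $b'_1,\ldots,b'_l\in\{0,1\}$ there exist $b''_1,\ldots,b''_l\in\{0,1\}$ such that for all $b_1,\ldots,b_n\in\{0,1\}$: $$\Big(\langle X\rangle \,/\, \big(\textstyle\bigoplus_{i=1}^n \mathrm{in}_i.\mathrm{BR}_{b_i} \oplus \bigoplus_{i=1}^l \mathrm{aux}_i.\mathrm{BR}_{b'_i}\big)\Big) \bullet \big(\textstyle\bigoplus_{i=1}^m \mathrm{out}_i.\mathrm{BR}_{0}\big) = \Big(\langle Y\rangle \,/\, \big(\textstyle\bigoplus_{i=1}^n \mathrm{in}_i.\mathrm{BR}_{b_i} \oplus \bigoplus_{i=1}^l \mathrm{aux}_i.\mathrm{BR}_{b''_i}\big)\Big) \bullet \big(\textstyle\bigoplus_{i=1}^m \mathrm{out}_i.\mathrm{BR}_{0}\big)$$ and $$\mathrm{depth}\Big(\big(\langle X\rangle /\!\!/ (\textstyle\bigoplus_{i=1}^n \mathrm{in}_i.\mathrm{BR}_{b_i} \oplus \bigoplus_{i=1}^l \mathrm{aux}_i.\mathrm{BR}_{b'_i})\big) /\!\!/ (\bigoplus_{i=1}^m \mathrm{out}_i.\mathrm{BR}_{0})\Big) = \mathrm{depth}\Big(\big(\langle Y\rangle /\!\!/ (\textstyle\bigoplus_{i=1}^n \mathrm{in}_i.\mathrm{BR}_{b_i} \oplus \bigoplus_{i=1}^l \mathrm{aux}_i.\mathrm{BR}_{b''_i})\big)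 /\!\!/ (\bigoplus_{i=1}^m \mathrm{out}_i.\mathrm{BR}_{0})\Big).$$
   Context: Fix $n,m\in\mathbb{N}$. Register names (foci): $\mathrm{in}_1,\ldots,\mathrm{in}_n$, $\mathrm{aux}_1,\mathrm{aux}_2,\ldots$ (one for each positive integer), $\mathrm{out}_1,\ldots,\mathrm{out}_m$. Methods: $\mathrm{set}{:}0,\mathrm{set}{:}1,\mathrm{get}$. The basic instructions are $\mathrm{in}_i.\mathrm{get}$ ($1\le i\le n$), $\mathrm{aux}_i.\mathrm{get}$, $\mathrm{aux}_i.\mathrm{set}{:}b$ ($i\ge1$, $b\in\{0,1\}$), $\mathrm{out}_j.\mathrm{set}{:}b$ ($1\le j\le m$, $b\in\{0,1\}$); a basic instruction $f.\mu$ has focus $f$ and method $\mu$. Primitive instructions: for each basic instruction $a$, the plain instruction $a$, the positive test $+a$ and the negative test $-a$; forward jumps $\#l$ for $l\in\mathbb{N}$; the termination instruction $!$. $\mathcal{IS}(n,m)$ is the set of all nonempty finite sequences $u_1;\ldots;u_k$ of primitive instructions. Threads are finite terms generated by: $\mathsf{S}$ (termination), $\mathsf{D}$ (inaction), and $x \trianglelefteq a \trianglerighteq y$ for threads $x,y$ and an action $a$; equality of threads is syntactic identity. Actions are the basic instructions and the trace actions $f.\mu!r$ ($f$ a focus, $\mu$ a method, $r\in\{0,1\}$). $a\circ x$ abbreviates $x \trianglelefteq a \trianglerighteq x$. $\mathcal{T}(n,m)$ is the set of threads whose actions are all basic instructions. The depth is defined by $\mathrm{depth}(\mathsf{S})=\mathrm{depth}(\mathsf{D})=0$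 and $\mathrm{depth}(x \trianglelefteq a \trianglerighteq y)=\max\{\mathrm{depth}(x),\mathrm{depth}(y)\}+1$. Thread extraction: for $X=u_1;\ldots;u_k$ define $T_j$ for $j\ge1$: $T_j=\mathsf{D}$ if $j>k$; otherwise $T_j=a\circ T_{j+1}$ if $u_j=a$; $T_j=T_{j+1}\trianglelefteq a\trianglerighteq T_{j+2}$ if $u_j=+a$; $T_j=T_{j+2}\trianglelefteq a\trianglerighteq T_{j+1}$ if $u_j=-a$; $T_j=\mathsf{D}$ if $u_j=\#0$; $T_j=T_{j+l}$ if $u_j=\#l$ with $l\ge1$; $T_j=\mathsf{S}$ if $u_j=!$. Then $\langle X\rangle=T_1$. Register families: a family is a finite partial map $F$ from foci to $\{0,1\}$ (register contents), written $\bigoplus f.\mathrm{BR}_{b}$ (here all families combined with $\oplus$ have distinct foci, so $\oplus$ is disjoint union); $\emptyset$ denotes the empty family. A register with content $b$ processing $\mathrm{set}{:}c$ replies $c$ and gets content $c$; processing $\mathrm{get}$ replies $b$ and keeps content $b$. For $f\in\mathrm{dom}F$ write $r$ for the reply of $F(f)$ to $\mu$ and $F'$ for $F$ with $f$'s content updated. Abstracting use $x/F$: $\mathsf{S}/F=\mathsf{S}$, $\mathsf{D}/F=\mathsf{D}$; $(x\trianglelefteq f.\mu\trianglerighteq y)/F=(x/F)\trianglelefteq f.\mu\trianglerighteq(y/F)$ if $f\notin\mathrm{dom}F$, and otherwise $=x/F'$ if $r=1$, $=y/F'$ if $r=0$; $(x\trianglelefteq f.\mu!r\trianglerighteq y)/F=f.\mu!r\circ(x/F)$.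 Apply $x\bullet F$ (a family): $\mathsf{S}\bullet F=F$, $\mathsf{D}\bullet F=\emptyset$; $(x\trianglelefteq f.\mu\trianglerighteq y)\bullet F=\emptyset$ if $f\notin\mathrm{dom}F$, and otherwise $=x\bullet F'$ if $r=1$, $=y\bullet F'$ if $r=0$; $(x\trianglelefteq f.\mu!r\trianglerighteq y)\bullet F=x\bullet F$. Tracking use $x/\!\!/F$: $\mathsf{S}/\!\!/F=\mathsf{S}$, $\mathsf{D}/\!\!/F=\mathsf{D}$; $(x\trianglelefteq f.\mu\trianglerighteq y)/\!\!/F=(x/\!\!/F)\trianglelefteq f.\mu\trianglerighteq(y/\!\!/F)$ if $f\notin\mathrm{dom}F$, and otherwise $=f.\mu!r\circ(x/\!\!/F')$ if $r=1$, $=f.\mu!r\circ(y/\!\!/F')$ if $r=0$; $(x\trianglelefteq f.\mu!r\trianglerighteq y)/\!\!/F=f.\mu!r\circ(x/\!\!/F)$. Relations on $\mathcal{IS}(n,m)$ (instructions are transformed position-wise, length preserved): (i) $X\approx_{\mathrm{b}}Y$ iff $\langle X\rangle=\langle Y\rangle$. (ii) $X\approx_{\mathrm{x}}Y$ iff $\chi_I(X)=Y$ for some finite $I\subset\mathbb{N}_{>0}$, where $\chi_I$ replaces each instruction with focus $\mathrm{aux}_i$, $i\in I$, as follows: the method $\mathrm{set}{:}0\leftrightarrow\mathrm{set}{:}1$ is swapped ($\mathrm{get}$ unchanged), and a positive test becomes a negative test and vice versa (plain stays plain); all other instructions are unchanged. (iii) $X\approx_{\mathrm{r}}Y$ iff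 $\rho_r(X)=Y$ for some bijection $r$ of $\mathbb{N}_{>0}$, where $\rho_r$ replaces every focus $\mathrm{aux}_i$ by $\mathrm{aux}_{r(i)}$ and leaves everything else unchanged. (iv) $X\approx_{\mathrm{t}}Y$ iff $\langle X\rangle\approx'_{\mathrm{t}}\langle Y\rangle$, where $\approx'_{\mathrm{t}}$ is the smallest relation on $\mathcal{T}(n,m)$ that is reflexive, transitive, satisfies $x\approx'_{\mathrm{t}}x',y\approx'_{\mathrm{t}}y'\Rightarrow (x\trianglelefteq a\trianglerighteq y)\approx'_{\mathrm{t}}(x'\trianglelefteq a\trianglerighteq y')$, and contains $(x\trianglelefteq b\trianglerighteq y)\trianglelefteq a\trianglerighteq(x'\trianglelefteq b\trianglerighteq y')\ \approx'_{\mathrm{t}}\ (x\trianglelefteq a\trianglerighteq x')\trianglelefteq b\trianglerighteq(y\trianglelefteq a\trianglerighteq y')$ for all basic instructions $a,b$ with different foci. Structural algorithmic equivalence $\simeq_{\mathrm{sa}}$ is the smallest transitive relation on $\mathcal{IS}(n,m)$ containing $\approx_{\mathrm{b}}\cup\approx_{\mathrm{x}}\cup\approx_{\mathrm{r}}\cup\approx_{\mathrm{t}}$. -}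

module Defs where

open import Data.Nat using (ℕ; zero; suc; _⊔_; _≡ᵇ_)
open import Data.Fin using (Fin)
import Data.Fin as Fin
open import Data.Bool using (Bool; true; false; not; if_then_else_; _∧_)
open import Data.Maybe using (Maybe; just; nothing)
open import Data.List using (List; []; _∷_; drop; length)
open import Data.Bool.ListAction using (any)
open import Data.List.NonEmpty using (List⁺; toList)
import Data.List.NonEmpty as L⁺
open import Data.Vec using (Vec; []; _∷_; lookup)
open import Data.Product using (∃-syntax; _×_; _,_)
open import Relation.Binary.PropositionalEquality using (_≡_; _≢_)
open import Function.Bundles using (_⤖_; Bijection)

-- Foci, methods, basic instructions.
-- NOTE: aux k (k : ℕ) stands for the paper's aux_{k+1}.

data Focus (n m : ℕ) : Set where
  inF  : Fin n → Focus n m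
  auxF : ℕ → Focus n m
  outF : Fin m → Focus n m

data Method : Set where
  set : Bool → Method      -- set:0 = set false, set:1 = set true
  get : Method

data Basic (n m : ℕ) : Set where
  inGet  : Fin n → Basic n m
  auxGet : ℕ → Basic n m
  auxSet : ℕ → Bool → Basic n m
  outSet : Fin m → Bool → Basic n m

focus : ∀ {n m} → Basic n m → Focus n m
focus (inGet i)    = inF i
focus (auxGet i)   = auxF i
focus (auxSet i _) = auxF i
focus (outSet j _) = outF j

method : ∀ {n m} → Basic n m → Method
method (inGet _)    = get
method (auxGet _)   = get
method (auxSet _ b) = set b
method (outSet _ b) = set b

_==F_ : ∀ {n m} → Focus n m → Focus n m → Bool
inF i  ==F inF j  = Fin.toℕ i ≡ᵇ Fin.toℕ j
auxF i ==F auxF j = i ≡ᵇ j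
outF i ==F outF j = Fin.toℕ i ≡ᵇ Fin.toℕ j
_      ==F _      = false

data Prim (n m : ℕ) : Set where
  plain : Basic n m → Prim n m
  pos   : Basic n m → Prim n m
  neg   : Basic n m → Prim n m
  jump  : ℕ → Prim n m
  halt  : Prim n m

IS : ℕ → ℕ → Set
IS n m = List⁺ (Prim n m)

data Action (n m : ℕ) : Set where
  bas   : Basic n m → Action n m
  trace : Focus n m → Method → Bool → Action n m

data Thread (n m : ℕ) : Set where
  S   : Thread n m
  D   : Thread n m
  _⊴_⊵_ : Thread n m → Action n m → Thread n m → Thread n m

_∘T_ : ∀ {n m} → Action n m → Thread n m → Thread n m
a ∘T x = x ⊴ a ⊵ x

depth : ∀ {n m} → Thread n m → ℕ
depth S = 0
depth D = 0
depth (x ⊴ _ ⊵ y) = suc (depth x ⊔ depth y)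

-- Thread extraction.  ext f us computes T_j where us = u_j;...;u_k
-- (fuel f ≥ length us suffices; T_j = D for j > k).

ext : ∀ {n m} → ℕ → List (Prim n m) → Thread n m
ext zero _ = D
ext (suc f) [] = D
ext (suc f) (plain a ∷ us) = bas a ∘T ext f us
ext (suc f) (pos a ∷ us) = ext f us ⊴ bas a ⊵ ext f (drop 1 us)
ext (suc f) (neg a ∷ us) = ext f (drop 1 us) ⊴ bas a ⊵ ext f us
ext (suc f) (jump zero ∷ us) = D
ext (suc f) (jump (suc l) ∷ us) = ext f (drop l us)
ext (suc f) (halt ∷ us) = S

⟨_⟩ : ∀ {n m} → IS n m → Thread n m
⟨ X ⟩ = ext (length (toList X)) (toList X)

-- Register families: finite partial maps from foci to contents,
-- represented as functions Focus → Maybe Bool (nothing = not in domain).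

Family : ℕ → ℕ → Set
Family n m = Focus n m → Maybe Bool

∅ : ∀ {n m} → Family n m
∅ _ = nothing

_≐_ : ∀ {n m} → Family n m → Family n m → Set
F ≐ G = ∀ f → F f ≡ G f

reply : Method → Bool → Bool
reply (set c) _ = c
reply get b = b

update : ∀ {n m} → Family n m → Focus n m → Bool → Family n m
update F f c g = if g ==F f then just c else F g

_/_ : ∀ {n m} → Thread n m → Family n m → Thread n m
S / F = S
D / F = D
(x ⊴ bas a ⊵ y) / F with F (focus a)
... | nothing = (x / F) ⊴ bas a ⊵ (y / F)
... | just b with reply (method a) b
...   | true  = x / update F (focus a) true
...   | false = y / update F (focus a) false
(x ⊴ trace f μ r ⊵ y) / F = trace f μ r ∘T (x / F)

_•_ : ∀ {n m} → Thread n m → Family n m → Family n m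
S • F = F
D • F = ∅
(x ⊴ bas a ⊵ y) • F with F (focus a)
... | nothing = ∅
... | just b with reply (method a) b
...   | true  = x • update F (focus a) true
...   | false = y • update F (focus a) false
(x ⊴ trace f μ r ⊵ y) • F = x • F

_//_ : ∀ {n m} → Thread n m → Family n m → Thread n m
S // F = S
D // F = D
(x ⊴ bas a ⊵ y) // F with F (focus a)
... | nothing = (x // F) ⊴ bas a ⊵ (y // F)
... | just b with reply (method a) b
...   | true  = trace (focus a) (method a) true ∘T (x // update F (focus a) true)
...   | false = trace (focus a) (method a) false ∘T (y // update F (focus a) false)
(x ⊴ trace f μ r ⊵ y) // F = trace f μ r ∘T (x // F)

auxLookup : ∀ {l} → Vec Bool l → ℕ → Maybe Bool
auxLookup [] _ = nothing
auxLookup (b ∷ bs) zero = just b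
auxLookup (b ∷ bs) (suc k) = auxLookup bs k

inAuxFam : ∀ {n m l} → Vec Bool n → Vec Bool l → Family n m
inAuxFam b b' (inF i)  = just (lookup b i)
inAuxFam b b' (auxF k) = auxLookup b' k
inAuxFam b b' (outF _) = nothing

outFam : ∀ {n m} → Family n m
outFam (inF _)  = nothing
outFam (auxF _) = nothing
outFam (outF _) = just false

-- (ii) χ_I, with I a finite set of aux indices given as a list
memb : ℕ → List ℕ → Bool
memb k I = any (λ j → k ≡ᵇ j) I

flipB : ∀ {n m} → Basic n m → Basic n m
flipB (auxSet i b) = auxSet i (not b)
flipB a = a

chiInstr : ∀ {n m} → List ℕ → Prim n m → Prim n m
chiInstr I (plain a) with focus a
... | auxF i = if memb i I then plain (flipB a) else plain a
... | _ = plain a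
chiInstr I (pos a) with focus a
... | auxF i = if memb i I then neg (flipB a) else pos a
... | _ = pos a
chiInstr I (neg a) with focus a
... | auxF i = if memb i I then pos (flipB a) else neg a
... | _ = neg a
chiInstr I u = u

χ : ∀ {n m} → List ℕ → IS n m → IS n m
χ I = L⁺.map (chiInstr I)

renB : ∀ {n m} → (ℕ → ℕ) → Basic n m → Basic n m
renB r (inGet i) = inGet i
renB r (auxGet i) = auxGet (r i)
renB r (auxSet i b) = auxSet (r i) b
renB r (outSet j b) = outSet j b

renInstr : ∀ {n m} → (ℕ → ℕ) → Prim n m → Prim n m
renInstr r (plain a) = plain (renB r a)
renInstr r (pos a) = pos (renB r a)
renInstr r (neg a) = neg (renB r a)
renInstr r u = u

ρ : ∀ {n m} → (ℕ ⤖ ℕ) → IS n m → IS n m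
ρ r = L⁺.map (renInstr (Bijection.to r))

data _≈t'_ {n m : ℕ} : Thread n m → Thread n m → Set where
  t-refl  : ∀ {x} → x ≈t' x
  t-trans : ∀ {x y z} → x ≈t' y → y ≈t' z → x ≈t' z
  t-cong  : ∀ {x x' y y'} (a : Basic n m) → x ≈t' x' → y ≈t' y' →
            (x ⊴ bas a ⊵ y) ≈t' (x' ⊴ bas a ⊵ y')
  t-swap  : ∀ (a b : Basic n m) {x y x' y'} → focus a ≢ focus b →
            ((x ⊴ bas b ⊵ y) ⊴ bas a ⊵ (x' ⊴ bas b ⊵ y'))
              ≈t' ((x ⊴ bas a ⊵ x') ⊴ bas b ⊵ (y ⊴ bas a ⊵ y'))

data _≃sa_ {n m : ℕ} : IS n m → IS n m → Set where
  sa-b : ∀ {X Y} → ⟨ X ⟩ ≡ ⟨ Y ⟩ → X ≃sa Y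
  sa-x : ∀ {X Y} (I : List ℕ) → χ I X ≡ Y → X ≃sa Y
  sa-r : ∀ {X Y} (r : ℕ ⤖ ℕ) → ρ r X ≡ Y → X ≃sa Y
  sa-t : ∀ {X Y} → ⟨ X ⟩ ≈t' ⟨ Y ⟩ → X ≃sa Y
  sa-trans : ∀ {X Y Z} → X ≃sa Y → Y ≃sa Z → X ≃sa Z

module Submission where

-- Both quantities are computed by one function 'observe', which runs a thread
-- against a configuration: a first family (used abstractly, here the input
-- and auxiliary registers) and a second family (applied, here the output
-- registers).  The four generators of the equivalence are then treated:
--   * identical extracted threads observe identically;
--   * the thread axiom '≈t'' is sound for 'observe', because queries of
--     registers with different foci commute;
--   * χ_I and ρ_r are both instances of one register relabelling (rename
--     auxiliary indices injectively, invert contents of selected ones), which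
--     commutes with thread extraction and is simulated by 'observe' as soon as
--     the auxiliary registers of the two runs correspond.
-- Each generator yields, for every sufficiently long auxiliary vector, a
-- translation of auxiliary contents preserving observations; these compose
-- along transitivity, and adequacy turns this into the theorem.

open import Defs
open import Data.Nat using (ℕ; zero; suc; _⊔_; _≡ᵇ_; _<_; _≤_; s≤s)
open import Data.Nat.Properties
  using (≡ᵇ⇒≡; ≤-refl; ≤-trans; <-≤-trans; ⊔-comm; ⊔-idem; m≤m⊔n; m≤n⊔m;
         m⊔n≤o⇒m≤o; m⊔n≤o⇒n≤o; m≤n⇒m<n∨m≡n; ⊔-commutativeSemigroup)
open import Algebra.Properties.CommutativeSemigroup ⊔-commutativeSemigroup using (interchange)
open import Data.Fin using (toℕ)
open import Data.Fin.Properties using (toℕ-injective)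
open import Data.Bool using (Bool; true; false; not; if_then_else_; _xor_; T)
open import Data.Maybe using (Maybe; just; nothing; fromMaybe)
import Data.Maybe as Maybe
open import Data.Maybe.Properties using (map-id)
open import Data.List using (List; []; _∷_; drop; length)
import Data.List as List
open import Data.List.Properties using (length-map; map-cong; drop-map)
open import Data.List.NonEmpty using (_∷_)
import Data.List.NonEmpty as List⁺
open import Data.Vec using (Vec; []; _∷_)
open import Data.Product using (Σ; ∃-syntax; _×_; _,_; proj₁; proj₂)
open import Data.Sum using (inj₁; inj₂)
open import Data.Empty using (⊥-elim)
open import Function.Bundles using (_⤖_; Bijection)
open import Relation.Binary.Bundles using (Setoid)
open import Relation.Binary.PropositionalEquality

if-comm : ∀ {A : Set} (b c : Bool) (x y x' y' : A) →
  (if c then (if b then x else x') else (if b then y else y'))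
    ≡ (if b then (if c then x else y) else (if c then x' else y'))
if-comm true  true  x y x' y' = refl
if-comm true  false x y x' y' = refl
if-comm false true  x y x' y' = refl
if-comm false false x y x' y' = refl

true≢false : true ≢ false
true≢false ()

just≢nothing : ∀ {c : Bool} → just c ≢ nothing
just≢nothing ()

≡ᵇ-refl : ∀ k → (k ≡ᵇ k) ≡ true
≡ᵇ-refl zero    = refl
≡ᵇ-refl (suc k) = ≡ᵇ-refl k

module _ {n m : ℕ} where

  ==F-sound : (f g : Focus n m) → f ==F g ≡ true → f ≡ g
  ==F-sound (inF i)  (inF j)  e = cong inF (toℕ-injective (≡ᵇ⇒≡ _ _ (subst T (sym e) _)))
  ==F-sound (auxF i) (auxF j) e = cong auxF (≡ᵇ⇒≡ _ _ (subst T (sym e) _))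
  ==F-sound (outF i) (outF j) e = cong outF (toℕ-injective (≡ᵇ⇒≡ _ _ (subst T (sym e) _)))
  ==F-sound (inF _)  (auxF _) ()
  ==F-sound (inF _)  (outF _) ()
  ==F-sound (auxF _) (inF _)  ()
  ==F-sound (auxF _) (outF _) ()
  ==F-sound (outF _) (inF _)  ()
  ==F-sound (outF _) (auxF _) ()

  ==F-false : {f g : Focus n m} → f ≢ g → f ==F g ≡ false
  ==F-false {f} {g} f≢g with f ==F g in e
  ... | true  = ⊥-elim (f≢g (==F-sound f g e))
  ... | false = refl

  ==F-refl : (f : Focus n m) → f ==F f ≡ true
  ==F-refl (inF i)  = ≡ᵇ-refl (toℕ i)
  ==F-refl (auxF i) = ≡ᵇ-refl i
  ==F-refl (outF j) = ≡ᵇ-refl (toℕ j)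

  update-cong : ∀ {F G : Family n m} f c → F ≐ G → update F f c ≐ update G f c
  update-cong f c F≐G g with g ==F f
  ... | true  = refl
  ... | false = F≐G g

  update-other : ∀ (F : Family n m) {f g} c → g ≢ f → update F f c g ≡ F g
  update-other F c g≢f rewrite ==F-false g≢f = refl

  update-comm : ∀ (F : Family n m) {f f'} c c' → f ≢ f' →
    update (update F f' c') f c ≐ update (update F f c) f' c'
  update-comm F {f} {f'} c c' f≢f' g with g ==F f in p | g ==F f' in q
  ... | true  | true  = ⊥-elim (f≢f' (trans (sym (==F-sound g f p)) (==F-sound g f' q)))
  ... | true  | false = refl
  ... | false | true  = refl
  ... | false | false = refl

  -- A configuration: the family used abstractly and the family applied.
  Config : Set
  Config = Family n m × Family n m

  _≐₂_ : Config → Config → Set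
  Φ ≐₂ Ψ = (proj₁ Φ ≐ proj₁ Ψ) × (proj₂ Φ ≐ proj₂ Ψ)

  ≐₂-refl : ∀ {Φ} → Φ ≐₂ Φ
  ≐₂-refl = (λ _ → refl) , (λ _ → refl)

  -- An observation: the resulting applied family and a depth.
  Observation : Set
  Observation = Family n m × ℕ

  tick : Observation → Observation
  tick (F , k) = F , suc k

  _≈O_ : Observation → Observation → Set
  o ≈O o' = (proj₁ o ≐ proj₁ o') × (proj₂ o ≡ proj₂ o')

  ≈O-setoid : Setoid _ _
  ≈O-setoid = record
    { Carrier = Observation ; _≈_ = _≈O_
    ; isEquivalence = record
      { refl  = (λ _ → refl) , refl
      ; sym   = λ (p , q) → (λ f → sym (p f)) , sym q
      ; trans = λ (p , q) (p' , q') → (λ f → trans (p f) (p' f)) , trans q q' } }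

  open Setoid ≈O-setoid public using () renaming (refl to ≈O-refl; sym to ≈O-sym; trans to ≈O-trans)

  ≡⇒≈O : ∀ {o o'} → o ≡ o' → o ≈O o'
  ≡⇒≈O refl = ≈O-refl

  tick-cong : ∀ {o o'} → o ≈O o' → tick o ≈O tick o'
  tick-cong (p , q) = p , cong suc q

  -- The register answering a query, found in one of the two families.
  data Side : Set where
    first second : Side

  data Lookup : Set where
    absent : Lookup
    found  : Side → Bool → Lookup

  consult : Maybe Bool → Maybe Bool → Method → Lookup
  consult (just c) _        μ = found first  (reply μ c)
  consult nothing  (just c) μ = found second (reply μ c)
  consult nothing  nothing  μ = absent

  query : Config → Basic n m → Lookup
  query Φ a = consult (proj₁ Φ (focus a)) (proj₂ Φ (focus a)) (method a)

  updateAt : Side → Focus n m → Bool → Config → Config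
  updateAt first  f c Φ = update (proj₁ Φ) f c , proj₂ Φ
  updateAt second f c Φ = proj₁ Φ , update (proj₂ Φ) f c

  -- 'observe x (F₁ , F₂)' is ((x / F₁) • F₂ , depth ((x // F₁) // F₂)),
  -- computed in one pass (see 'observe-apply' and 'observe-depth').
  mutual
    observe : Thread n m → Config → Observation
    observe S Φ = proj₂ Φ , 0
    observe D Φ = ∅ , 0
    observe (x ⊴ bas a ⊵ y) Φ = continue x y (focus a) Φ (query Φ a)
    observe (x ⊴ trace _ _ _ ⊵ y) Φ = tick (observe x Φ)

    continue : Thread n m → Thread n m → Focus n m → Config → Lookup → Observation
    continue x y f Φ absent = ∅ , suc (proj₂ (observe x Φ) ⊔ proj₂ (observe y Φ))
    continue x y f Φ (found s true)  = tick (observe x (updateAt s f true Φ))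
    continue x y f Φ (found s false) = tick (observe y (updateAt s f false Φ))

  depthAt : Thread n m → Config → ℕ
  depthAt x Φ = proj₂ (observe x Φ)

  observe-apply : ∀ x (F₁ F₂ : Family n m) → (x / F₁) • F₂ ≡ proj₁ (observe x (F₁ , F₂))
  observe-apply S F₁ F₂ = refl
  observe-apply D F₁ F₂ = refl
  observe-apply (x ⊴ trace _ _ _ ⊵ y) F₁ F₂ = observe-apply x F₁ F₂
  observe-apply (x ⊴ bas a ⊵ y) F₁ F₂ with F₁ (focus a)
  ... | just c with reply (method a) c
  ...   | true  = observe-apply x _ F₂
  ...   | false = observe-apply y _ F₂
  observe-apply (x ⊴ bas a ⊵ y) F₁ F₂ | nothing with F₂ (focus a)
  ... | nothing = refl
  ... | just c with reply (method a) c
  ...   | true  = observe-apply x F₁ _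
  ...   | false = observe-apply y F₁ _

  observe-depth : ∀ x (F₁ F₂ : Family n m) → depth ((x // F₁) // F₂) ≡ depthAt x (F₁ , F₂)
  observe-depth S F₁ F₂ = refl
  observe-depth D F₁ F₂ = refl
  observe-depth (x ⊴ trace _ _ _ ⊵ y) F₁ F₂ = cong suc (trans (⊔-idem _) (observe-depth x F₁ F₂))
  observe-depth (x ⊴ bas a ⊵ y) F₁ F₂ with F₁ (focus a)
  ... | just c with reply (method a) c
  ...   | true  = cong suc (trans (⊔-idem _) (observe-depth x _ F₂))
  ...   | false = cong suc (trans (⊔-idem _) (observe-depth y _ F₂))
  observe-depth (x ⊴ bas a ⊵ y) F₁ F₂ | nothing with F₂ (focus a)
  ... | nothing = cong suc (cong₂ _⊔_ (observe-depth x F₁ F₂) (observe-depth y F₁ F₂))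
  ... | just c with reply (method a) c
  ...   | true  = cong suc (trans (⊔-idem _) (observe-depth x F₁ _))
  ...   | false = cong suc (trans (⊔-idem _) (observe-depth y F₁ _))

  adequacy : ∀ x y {F₁ F₂ G₁ G₂ : Family n m} → observe x (F₁ , F₂) ≈O observe y (G₁ , G₂) →
    (((x / F₁) • F₂) ≐ ((y / G₁) • G₂)) × (depth ((x // F₁) // F₂) ≡ depth ((y // G₁) // G₂))
  adequacy x y {F₁} {F₂} {G₁} {G₂} (same-family , same-depth) =
      (λ f → trans (cong-app (observe-apply x F₁ F₂) f)
               (trans (same-family f) (sym (cong-app (observe-apply y G₁ G₂) f))))
    , trans (observe-depth x F₁ F₂) (trans same-depth (sym (observe-depth y G₁ G₂)))

  -- A node whose branches are exchanged iff δ; relabellings that invert a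
  -- register produce such nodes.
  branch : Bool → Thread n m → Action n m → Thread n m → Thread n m
  branch δ x c y = (if δ then y else x) ⊴ c ⊵ (if δ then x else y)

  module Simulation (Corr : Config → Config → Set) where

    Simulates : Thread n m → Thread n m → Set
    Simulates x x' = ∀ Φ Ψ → Corr Φ Ψ → observe x Φ ≈O observe x' Ψ

    data Match (f f' : Focus n m) (δ : Bool) (Φ Ψ : Config) : Lookup → Lookup → Set where
      both-absent : Corr Φ Ψ → Match f f' δ Φ Ψ absent absent
      both-found  : ∀ s r → Corr (updateAt s f r Φ) (updateAt s f' (δ xor r) Ψ) →
                    Match f f' δ Φ Ψ (found s r) (found s (δ xor r))

    continue-sim : ∀ {x y x' y' f f' δ Φ Ψ ℓ ℓ'} → Simulates x x' → Simulates y y' →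
      Match f f' δ Φ Ψ ℓ ℓ' →
      continue x y f Φ ℓ ≈O continue (if δ then y' else x') (if δ then x' else y') f' Ψ ℓ'
    continue-sim {δ = false} sx sy (both-absent c) =
      (λ _ → refl) , cong suc (cong₂ _⊔_ (proj₂ (sx _ _ c)) (proj₂ (sy _ _ c)))
    continue-sim {x' = x'} {y'} {δ = true} {Ψ = Ψ} sx sy (both-absent c) =
      (λ _ → refl) , cong suc (trans (cong₂ _⊔_ (proj₂ (sx _ _ c)) (proj₂ (sy _ _ c)))
                                     (⊔-comm (depthAt x' Ψ) (depthAt y' Ψ)))
    continue-sim {δ = false} sx sy (both-found s true c)  = tick-cong (sx _ _ c)
    continue-sim {δ = false} sx sy (both-found s false c) = tick-cong (sy _ _ c)
    continue-sim {δ = true}  sx sy (both-found s true c)  = tick-cong (sx _ _ c)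
    continue-sim {δ = true}  sx sy (both-found s false c) = tick-cong (sy _ _ c)

  module Pointwise = Simulation _≐₂_

  updateAt-cong : ∀ {Φ Ψ} s f c → Φ ≐₂ Ψ → updateAt s f c Φ ≐₂ updateAt s f c Ψ
  updateAt-cong first  f c (e₁ , e₂) = update-cong f c e₁ , e₂
  updateAt-cong second f c (e₁ , e₂) = e₁ , update-cong f c e₂

  match-pointwise : ∀ {Φ Ψ} a → Φ ≐₂ Ψ →
    Pointwise.Match (focus a) (focus a) false Φ Ψ (query Φ a) (query Ψ a)
  match-pointwise {Φ} {Ψ} a e@(e₁ , e₂)
    rewrite e₁ (focus a) | e₂ (focus a) with query Ψ a
  ... | absent    = Pointwise.both-absent e
  ... | found s r = Pointwise.both-found s r (updateAt-cong s (focus a) r e)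

  observe-ext : ∀ x → Pointwise.Simulates x x
  observe-ext S Φ Ψ (_ , e₂) = e₂ , refl
  observe-ext D Φ Ψ e = ≈O-refl
  observe-ext (x ⊴ trace _ _ _ ⊵ y) Φ Ψ e = tick-cong (observe-ext x Φ Ψ e)
  observe-ext (x ⊴ bas a ⊵ y) Φ Ψ e =
    Pointwise.continue-sim (observe-ext x) (observe-ext y) (match-pointwise a e)

  -- Soundness of the thread axioms: queries of different foci commute.

  continue-found : ∀ x y f Φ s r →
    continue x y f Φ (found s r) ≡ tick (observe (if r then x else y) (updateAt s f r Φ))
  continue-found x y f Φ s true  = refl
  continue-found x y f Φ s false = refl

  observe-found : ∀ x y {a Φ s r} → query Φ a ≡ found s r →
    observe (x ⊴ bas a ⊵ y) Φ ≡ tick (observe (if r then x else y) (updateAt s (focus a) r Φ))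
  observe-found x y {a} {Φ} {s} {r} e =
    trans (cong (continue x y (focus a) Φ) e) (continue-found x y (focus a) Φ s r)

  observe-absent : ∀ x y {a Φ} → query Φ a ≡ absent →
    observe (x ⊴ bas a ⊵ y) Φ ≡ (∅ , suc (depthAt x Φ ⊔ depthAt y Φ))
  observe-absent x y {a} {Φ} e = cong (continue x y (focus a) Φ) e

  query-after : ∀ Φ s {f} c b → focus b ≢ f → query (updateAt s f c Φ) b ≡ query Φ b
  query-after Φ first  c b ne = cong (λ u → consult u _ (method b)) (update-other (proj₁ Φ) c ne)
  query-after Φ second c b ne = cong (λ u → consult _ u (method b)) (update-other (proj₂ Φ) c ne)

  updateAt-comm : ∀ Φ s s' {f f'} c c' → f ≢ f' →
    updateAt s f c (updateAt s' f' c' Φ) ≐₂ updateAt s' f' c' (updateAt s f c Φ)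
  updateAt-comm Φ first  first  c c' ne = update-comm (proj₁ Φ) c c' ne , (λ _ → refl)
  updateAt-comm Φ first  second c c' ne = (λ _ → refl) , (λ _ → refl)
  updateAt-comm Φ second first  c c' ne = (λ _ → refl) , (λ _ → refl)
  updateAt-comm Φ second second c c' ne = (λ _ → refl) , update-comm (proj₂ Φ) c c' ne

  queryBoth : Basic n m → Basic n m → (x y x' y' : Thread n m) → Thread n m
  queryBoth a b x y x' y' = (x ⊴ bas b ⊵ y) ⊴ bas a ⊵ (x' ⊴ bas b ⊵ y')

  after-first : ∀ {a b x y x' y' Φ s r} → focus a ≢ focus b → query Φ a ≡ found s r →
    observe (queryBoth a b x y x' y') Φ
      ≡ tick (continue (if r then x else x') (if r then y else y') (focus b)
                       (updateAt s (focus a) r Φ) (query Φ b))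
  after-first {a} {b} {x} {y} {x'} {y'} {Φ} {s} {r} ne e = begin
    observe (queryBoth a b x y x' y') Φ
      ≡⟨ observe-found (x ⊴ bas b ⊵ y) (x' ⊴ bas b ⊵ y') e ⟩
    tick (observe (if r then x ⊴ bas b ⊵ y else x' ⊴ bas b ⊵ y') Φa)
      ≡⟨ cong (λ t → tick (observe t Φa)) (if-node r) ⟩
    tick (continue (if r then x else x') (if r then y else y') (focus b) Φa (query Φa b))
      ≡⟨ cong (λ ℓ → tick (continue _ _ (focus b) Φa ℓ)) (query-after Φ s r b (λ e → ne (sym e))) ⟩
    tick (continue (if r then x else x') (if r then y else y') (focus b) Φa (query Φ b)) ∎
    where
    open ≡-Reasoning
    Φa = updateAt s (focus a) r Φ
    if-node : ∀ r → (if r then x ⊴ bas b ⊵ y else x' ⊴ bas b ⊵ y')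
                      ≡ ((if r then x else x') ⊴ bas b ⊵ (if r then y else y'))
    if-node true  = refl
    if-node false = refl

  after-both : ∀ {a b x y x' y' Φ sa ra sb rb} → focus a ≢ focus b →
    query Φ a ≡ found sa ra → query Φ b ≡ found sb rb →
    observe (queryBoth a b x y x' y') Φ
      ≡ tick (tick (observe (if rb then (if ra then x else x') else (if ra then y else y'))
                            (updateAt sb (focus b) rb (updateAt sa (focus a) ra Φ))))
  after-both {sb = sb} {rb} ne ea eb =
    trans (after-first ne ea)
          (cong tick (trans (cong (continue _ _ _ _) eb) (continue-found _ _ _ _ sb rb)))

  -- Both found: both orders end in the same branch after commuting updates.
  swap-found-found : ∀ {a b x y x' y' Φ sa ra sb rb} → focus a ≢ focus b →
    query Φ a ≡ found sa ra → query Φ b ≡ found sb rb →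
    observe (queryBoth a b x y x' y') Φ ≈O observe (queryBoth b a x x' y y') Φ
  swap-found-found {a} {b} {x} {y} {x'} {y'} {Φ} {sa} {ra} {sb} {rb} ne ea eb = begin
    observe (queryBoth a b x y x' y') Φ
      ≡⟨ after-both ne ea eb ⟩
    tick (tick (observe (if rb then (if ra then x else x') else (if ra then y else y'))
                        (updateAt sb (focus b) rb (updateAt sa (focus a) ra Φ))))
      ≡⟨ cong (λ t → tick (tick (observe t _))) (if-comm ra rb x y x' y') ⟩
    tick (tick (observe selected (updateAt sb (focus b) rb (updateAt sa (focus a) ra Φ))))
      ≈⟨ tick-cong (tick-cong (observe-ext selected _ _ (updateAt-comm Φ sb sa rb ra (λ e → ne (sym e))))) ⟩
    tick (tick (observe selected (updateAt sa (focus a) ra (updateAt sb (focus b) rb Φ))))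
      ≡⟨ sym (after-both (λ e → ne (sym e)) eb ea) ⟩
    observe (queryBoth b a x x' y y') Φ ∎
    where
    open import Relation.Binary.Reasoning.Setoid ≈O-setoid
    selected = if ra then (if rb then x else y) else (if rb then x' else y')

  -- The register for b is absent: both orders stop at b, one level deep.
  swap-found-absent : ∀ {a b x y x' y' Φ s r} → focus a ≢ focus b →
    query Φ a ≡ found s r → query Φ b ≡ absent →
    observe (queryBoth a b x y x' y') Φ ≡ observe (queryBoth b a x x' y y') Φ
  swap-found-absent {a} {b} {x} {y} {x'} {y'} {Φ} {s} {r} ne ea eb = begin
    observe (queryBoth a b x y x' y') Φ
      ≡⟨ trans (after-first ne ea) (cong (λ ℓ → tick (continue _ _ (focus b) _ ℓ)) eb) ⟩
    (∅ , suc (suc (depthAt (if r then x else x') Φa ⊔ depthAt (if r then y else y') Φa)))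
      ≡⟨ sym (cong₂ (λ u v → ∅ , suc (proj₂ u ⊔ proj₂ v)) (observe-found x x' ea) (observe-found y y' ea)) ⟩
    (∅ , suc (depthAt (x ⊴ bas a ⊵ x') Φ ⊔ depthAt (y ⊴ bas a ⊵ y') Φ))
      ≡⟨ sym (observe-absent (x ⊴ bas a ⊵ x') (y ⊴ bas a ⊵ y') eb) ⟩
    observe (queryBoth b a x x' y y') Φ ∎
    where
    open ≡-Reasoning
    Φa = updateAt s (focus a) r Φ

  -- Both registers absent: the depths agree by interchange of maxima.
  swap-absent-absent : ∀ {a b x y x' y' Φ} → query Φ a ≡ absent → query Φ b ≡ absent →
    observe (queryBoth a b x y x' y') Φ ≡ observe (queryBoth b a x x' y y') Φ
  swap-absent-absent {a} {b} {x} {y} {x'} {y'} {Φ} ea eb = begin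
    observe (queryBoth a b x y x' y') Φ
      ≡⟨ trans (observe-absent (x ⊴ bas b ⊵ y) (x' ⊴ bas b ⊵ y') ea)
               (cong₂ (λ u v → ∅ , suc (proj₂ u ⊔ proj₂ v)) (observe-absent x y eb) (observe-absent x' y' eb)) ⟩
    (∅ , suc (suc (depthAt x Φ ⊔ depthAt y Φ) ⊔ suc (depthAt x' Φ ⊔ depthAt y' Φ)))
      ≡⟨ cong (λ k → ∅ , suc (suc k)) (interchange (depthAt x Φ) (depthAt y Φ) (depthAt x' Φ) (depthAt y' Φ)) ⟩
    (∅ , suc (suc (depthAt x Φ ⊔ depthAt x' Φ) ⊔ suc (depthAt y Φ ⊔ depthAt y' Φ)))
      ≡⟨ sym (trans (observe-absent (x ⊴ bas a ⊵ x') (y ⊴ bas a ⊵ y') eb)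
                    (cong₂ (λ u v → ∅ , suc (proj₂ u ⊔ proj₂ v)) (observe-absent x x' ea) (observe-absent y y' ea))) ⟩
    observe (queryBoth b a x x' y y') Φ ∎
    where open ≡-Reasoning

  observe-swap : ∀ a b {x y x' y'} → focus a ≢ focus b → ∀ Φ →
    observe (queryBoth a b x y x' y') Φ ≈O observe (queryBoth b a x x' y y') Φ
  observe-swap a b {x} {y} {x'} {y'} ne Φ = by-cases (query Φ a) (query Φ b) refl refl
    where
    by-cases : ∀ ℓa ℓb → query Φ a ≡ ℓa → query Φ b ≡ ℓb →
      observe (queryBoth a b x y x' y') Φ ≈O observe (queryBoth b a x x' y y') Φ
    by-cases (found _ _) (found _ _) ea eb = swap-found-found {x = x} {y} {x'} {y'} {Φ} ne ea eb
    by-cases (found _ _) absent      ea eb = ≡⇒≈O (swap-found-absent {x = x} {y} {x'} {y'} {Φ} ne ea eb)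
    by-cases absent      (found _ _) ea eb =
      ≈O-sym (≡⇒≈O (swap-found-absent {x = x} {x'} {y} {y'} {Φ} (λ e → ne (sym e)) eb ea))
    by-cases absent      absent      ea eb = ≡⇒≈O (swap-absent-absent {x = x} {y} {x'} {y'} {Φ} ea eb)

  observe-≈t : ∀ {x y : Thread n m} → x ≈t' y → Pointwise.Simulates x y
  observe-≈t {x} t-refl = observe-ext x
  observe-≈t (t-trans p q) Φ Ψ e = ≈O-trans (observe-≈t p Φ Ψ e) (observe-≈t q Ψ Ψ ≐₂-refl)
  observe-≈t (t-cong a p q) Φ Ψ e =
    Pointwise.continue-sim (observe-≈t p) (observe-≈t q) (match-pointwise a e)
  observe-≈t (t-swap a b {x} {y} {x'} {y'} ne) Φ Ψ e =
    ≈O-trans (observe-swap a b ne Φ) (observe-ext (queryBoth b a x x' y y') Φ Ψ e)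

  focusBound : Focus n m → ℕ
  focusBound (auxF i) = suc i
  focusBound _        = 0

  auxBound : Thread n m → ℕ
  auxBound S = 0
  auxBound D = 0
  auxBound (x ⊴ bas a ⊵ y) = focusBound (focus a) ⊔ (auxBound x ⊔ auxBound y)
  auxBound (x ⊴ trace _ _ _ ⊵ y) = auxBound x ⊔ auxBound y

  OutOnly : Family n m → Set
  OutOnly F = ∀ k → F (auxF k) ≡ nothing

  outOnly-update : ∀ {F f c} r → OutOnly F → F f ≡ just c → OutOnly (update F f r)
  outOnly-update {F} {f} r noAux e k with auxF k ==F f in q
  ... | true  = ⊥-elim (just≢nothing (trans (sym e) (trans (cong F (sym (==F-sound (auxF k) f q))) (noAux k))))
  ... | false = noAux k

  test : Bool → Basic n m → Prim n m
  test false = pos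
  test true  = neg

  ext-test : ∀ δ f a us →
    ext (suc f) (test δ a ∷ us) ≡ branch δ (ext f us) (bas a) (ext f (drop 1 us))
  ext-test false f a us = refl
  ext-test true  f a us = refl

  branch-same : ∀ δ t c → branch δ t c t ≡ c ∘T t
  branch-same false t c = refl
  branch-same true  t c = refl

  branch-not : ∀ δ x c y → branch (not δ) x c y ≡ branch δ y c x
  branch-not false x c y = refl
  branch-not true  x c y = refl

-- Register relabellings: auxiliary register i becomes r i, and its content
-- is inverted iff d i.  Both χ_I and ρ_r are of this form.

module Relabelling {n m : ℕ} (r : ℕ → ℕ) (d : ℕ → Bool) where

  renF : Focus n m → Focus n m
  renF (auxF i) = auxF (r i)
  renF f        = f

  flips : Focus n m → Bool
  flips (auxF i) = d i
  flips _        = false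

  relB : Basic n m → Basic n m
  relB (inGet i)    = inGet i
  relB (auxGet i)   = auxGet (r i)
  relB (auxSet i b) = auxSet (r i) (d i xor b)
  relB (outSet j b) = outSet j b

  relT : Thread n m → Thread n m
  relT S = S
  relT D = D
  relT (x ⊴ bas a ⊵ y) = branch (flips (focus a)) (relT x) (bas (relB a)) (relT y)
  relT (x ⊴ trace f μ c ⊵ y) = relT x ⊴ trace f μ c ⊵ relT y

  relI : Prim n m → Prim n m
  relI (plain a) = plain (relB a)
  relI (pos a)   = test (flips (focus a)) (relB a)
  relI (neg a)   = test (not (flips (focus a))) (relB a)
  relI u         = u

  -- Thread extraction commutes with relabelling (also after dropping one
  -- instruction, the false branch of a test).
  ext-relI-drop : ∀ f us → ext f (drop 1 (List.map relI us)) ≡ relT (ext f (drop 1 us))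
  ext-relI : ∀ f us → ext f (List.map relI us) ≡ relT (ext f us)
  ext-relI zero    us = refl
  ext-relI (suc f) [] = refl
  ext-relI (suc f) (plain a ∷ us) =
    trans (cong (bas (relB a) ∘T_) (ext-relI f us)) (sym (branch-same _ _ _))
  ext-relI (suc f) (pos a ∷ us) =
    trans (ext-test _ f (relB a) _) (cong₂ (λ u v → branch _ u _ v) (ext-relI f us) (ext-relI-drop f us))
  ext-relI (suc f) (neg a ∷ us) =
    trans (ext-test _ f (relB a) _)
          (trans (cong₂ (λ u v → branch _ u _ v) (ext-relI f us) (ext-relI-drop f us))
                 (branch-not (flips (focus a)) _ _ _))
  ext-relI (suc f) (jump zero ∷ us) = refl
  ext-relI (suc f) (jump (suc l) ∷ us) = trans (cong (ext f) (drop-map l us)) (ext-relI f (drop l us))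
  ext-relI (suc f) (halt ∷ us) = refl

  ext-relI-drop f us = trans (cong (ext f) (drop-map 1 us)) (ext-relI f (drop 1 us))

  extract-relabel : (g : Prim n m → Prim n m) → (∀ u → g u ≡ relI u) →
    ∀ X → ⟨ List⁺.map g X ⟩ ≡ relT ⟨ X ⟩
  extract-relabel g g≗relI (u ∷ us) =
    trans (cong₂ ext (length-map g (u ∷ us)) (map-cong g≗relI (u ∷ us))) (ext-relI (length (u ∷ us)) (u ∷ us))

  renF-injective : (∀ {i j} → r i ≡ r j → i ≡ j) → ∀ {f g} → renF f ≡ renF g → f ≡ g
  renF-injective inj {inF _}  {inF _}  refl = refl
  renF-injective inj {outF _} {outF _} refl = refl
  renF-injective inj {auxF i} {auxF j} e    = cong auxF (inj (cong index e))
    where index : Focus n m → ℕ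
          index (auxF k) = k
          index _        = 0
  renF-injective inj {inF _}  {auxF _} ()
  renF-injective inj {inF _}  {outF _} ()
  renF-injective inj {auxF _} {inF _}  ()
  renF-injective inj {auxF _} {outF _} ()
  renF-injective inj {outF _} {inF _}  ()
  renF-injective inj {outF _} {auxF _} ()

  renF-==F : (∀ {i j} → r i ≡ r j → i ≡ j) → ∀ g f → renF g ==F renF f ≡ g ==F f
  renF-==F inj g f with g ==F f in e
  ... | true rewrite ==F-sound g f e = ==F-refl (renF f)
  ... | false = ==F-false λ re → true≢false (trans (sym (==F-refl g))
                                                    (trans (cong (g ==F_) (renF-injective inj re)) e))

  outOnly-renF : ∀ {F : Family n m} → OutOnly F → ∀ g → F (renF g) ≡ F g
  outOnly-renF noAux (inF _)  = refl
  outOnly-renF noAux (auxF i) = trans (noAux (r i)) (sym (noAux i))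
  outOnly-renF noAux (outF _) = refl

  module Simulated (inj : ∀ {i j} → r i ≡ r j → i ≡ j) (B : ℕ) where

    Corr : Config {n} {m} → Config → Set
    Corr Φ Ψ = (∀ g → focusBound g ≤ B → proj₁ Ψ (renF g) ≡ Maybe.map (flips g xor_) (proj₁ Φ g))
             × (proj₂ Ψ ≐ proj₂ Φ) × OutOnly (proj₂ Φ)

    open Simulation Corr

    corr-first : ∀ {Φ Ψ} → Corr Φ Ψ → ∀ f c →
      Corr (updateAt first f c Φ) (updateAt first (renF f) (flips f xor c) Ψ)
    corr-first {Φ} {Ψ} (c₁ , c₂ , c₃) f c = updated , c₂ , c₃
      where
      updated : ∀ g → focusBound g ≤ B →
        update (proj₁ Ψ) (renF f) (flips f xor c) (renF g) ≡ Maybe.map (flips g xor_) (update (proj₁ Φ) f c g)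
      updated g bg rewrite renF-==F inj g f with g ==F f in e
      ... | true  = cong (λ h → just (flips h xor c)) (sym (==F-sound g f e))
      ... | false = c₁ g bg

    -- A register found in the applied family is not auxiliary, hence neither
    -- renamed nor inverted.
    found-second : ∀ {Φ Ψ} f c μ μ' → (∀ c → reply μ' (flips f xor c) ≡ flips f xor reply μ c) →
      Corr Φ Ψ → proj₂ Φ f ≡ just c →
      Match f (renF f) (flips f) Φ Ψ (found second (reply μ c)) (found second (reply μ' c))
    found-second (auxF i) c μ μ' compat (_ , _ , c₃) e = ⊥-elim (just≢nothing (trans (sym e) (c₃ i)))
    found-second {Φ} (inF i) c μ μ' compat (c₁ , c₂ , c₃) e rewrite compat c =
      both-found second (reply μ c) (c₁ , update-cong (inF i) (reply μ c) c₂ , outOnly-update {F = proj₂ Φ} (reply μ c) c₃ e)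
    found-second {Φ} (outF j) c μ μ' compat (c₁ , c₂ , c₃) e rewrite compat c =
      both-found second (reply μ c) (c₁ , update-cong (outF j) (reply μ c) c₂ , outOnly-update {F = proj₂ Φ} (reply μ c) c₃ e)

    match-at : ∀ {Φ Ψ} f μ μ' → (∀ c → reply μ' (flips f xor c) ≡ flips f xor reply μ c) →
      focusBound f ≤ B → Corr Φ Ψ →
      Match f (renF f) (flips f) Φ Ψ (consult (proj₁ Φ f) (proj₂ Φ f) μ)
                                     (consult (proj₁ Ψ (renF f)) (proj₂ Ψ (renF f)) μ')
    match-at {Φ} {Ψ} f μ μ' compat bf C@(c₁ , c₂ , c₃) =
      subst (Match f (renF f) (flips f) Φ Ψ (consult (proj₁ Φ f) (proj₂ Φ f) μ))
            (sym (cong₂ (λ u v → consult u v μ') (c₁ f bf) (trans (c₂ (renF f)) (outOnly-renF {proj₂ Φ} c₃ f))))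
            (by-lookup (proj₁ Φ f) (proj₂ Φ f) refl)
      where
      by-lookup : ∀ u v → proj₂ Φ f ≡ v →
        Match f (renF f) (flips f) Φ Ψ (consult u v μ) (consult (Maybe.map (flips f xor_) u) v μ')
      by-lookup (just c) v _ rewrite compat c = both-found first (reply μ c) (corr-first {Φ} {Ψ} C f (reply μ c))
      by-lookup nothing (just c) e = found-second f c μ μ' compat C e
      by-lookup nothing nothing  _ = both-absent C

    match-relabel : ∀ {Φ Ψ} a → focusBound (focus a) ≤ B → Corr Φ Ψ →
      Match (focus a) (focus (relB a)) (flips (focus a)) Φ Ψ (query Φ a) (query Ψ (relB a))
    match-relabel (inGet i)    = match-at (inF i)  get     get               (λ _ → refl)
    match-relabel (auxGet i)   = match-at (auxF i) get     get               (λ _ → refl)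
    match-relabel (auxSet i b) = match-at (auxF i) (set b) (set (d i xor b)) (λ _ → refl)
    match-relabel (outSet j b) = match-at (outF j) (set b) (set b)           (λ _ → refl)

    relabel-sim : ∀ x → auxBound x ≤ B → Simulates x (relT x)
    relabel-sim S _ Φ Ψ (_ , c₂ , _) = (λ f → sym (c₂ f)) , refl
    relabel-sim D _ Φ Ψ _ = ≈O-refl
    relabel-sim (x ⊴ trace _ _ _ ⊵ y) bnd Φ Ψ C =
      tick-cong (relabel-sim x (m⊔n≤o⇒m≤o _ _ bnd) Φ Ψ C)
    relabel-sim (x ⊴ bas a ⊵ y) bnd Φ Ψ C =
      continue-sim {x} {y} {relT x} {relT y} (relabel-sim x (m⊔n≤o⇒m≤o _ _ bxy))
                   (relabel-sim y (m⊔n≤o⇒n≤o _ _ bxy)) (match-relabel {Φ} {Ψ} a (m⊔n≤o⇒m≤o _ _ bnd) C)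
      where bxy = m⊔n≤o⇒n≤o (focusBound (focus a)) _ bnd

chi-relabel : ∀ {n m} I (u : Prim n m) → chiInstr I u ≡ Relabelling.relI (λ i → i) (λ i → memb i I) u
chi-relabel I (plain (inGet i))    = refl
chi-relabel I (plain (outSet j b)) = refl
chi-relabel I (plain (auxGet i)) with memb i I
... | true  = refl
... | false = refl
chi-relabel I (plain (auxSet i b)) with memb i I
... | true  = refl
... | false = refl
chi-relabel I (pos (inGet i))    = refl
chi-relabel I (pos (outSet j b)) = refl
chi-relabel I (pos (auxGet i)) with memb i I
... | true  = refl
... | false = refl
chi-relabel I (pos (auxSet i b)) with memb i I
... | true  = refl
... | false = refl
chi-relabel I (neg (inGet i))    = refl
chi-relabel I (neg (outSet j b)) = refl
chi-relabel I (neg (auxGet i)) with memb i I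
... | true  = refl
... | false = refl
chi-relabel I (neg (auxSet i b)) with memb i I
... | true  = refl
... | false = refl
chi-relabel I (jump l) = refl
chi-relabel I halt     = refl

ren-relabel : ∀ {n m} r (u : Prim n m) → renInstr r u ≡ Relabelling.relI r (λ _ → false) u
ren-relabel r (plain (inGet i))    = refl
ren-relabel r (plain (auxGet i))   = refl
ren-relabel r (plain (auxSet i b)) = refl
ren-relabel r (plain (outSet j b)) = refl
ren-relabel r (pos (inGet i))      = refl
ren-relabel r (pos (auxGet i))     = refl
ren-relabel r (pos (auxSet i b))   = refl
ren-relabel r (pos (outSet j b))   = refl
ren-relabel r (neg (inGet i))      = refl
ren-relabel r (neg (auxGet i))     = refl
ren-relabel r (neg (auxSet i b))   = refl
ren-relabel r (neg (outSet j b))   = refl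
ren-relabel r (jump l) = refl
ren-relabel r halt     = refl

invertAux : ∀ {l} → (ℕ → Bool) → Vec Bool l → Vec Bool l
invertAux d []       = []
invertAux d (b ∷ bs) = (d 0 xor b) ∷ invertAux (λ k → d (suc k)) bs

invertAux-lookup : ∀ {l} d (v : Vec Bool l) k →
  auxLookup (invertAux d v) k ≡ Maybe.map (d k xor_) (auxLookup v k)
invertAux-lookup d []      k       = refl
invertAux-lookup d (b ∷ v) zero    = refl
invertAux-lookup d (b ∷ v) (suc k) = invertAux-lookup (λ k → d (suc k)) v k

tabulateAux : (l : ℕ) → (ℕ → Bool) → Vec Bool l
tabulateAux zero    g = []
tabulateAux (suc l) g = g 0 ∷ tabulateAux l (λ k → g (suc k))

tabulateAux-lookup : ∀ l g {j} → j < l → auxLookup (tabulateAux l g) j ≡ just (g j)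
tabulateAux-lookup (suc l) g {zero}  _       = refl
tabulateAux-lookup (suc l) g {suc j} (s≤s p) = tabulateAux-lookup l (λ k → g (suc k)) p

lookup-defined : ∀ {l} (v : Vec Bool l) {i} → i < l → auxLookup v i ≡ just (fromMaybe false (auxLookup v i))
lookup-defined (b ∷ v) {zero}  _       = refl
lookup-defined (b ∷ v) {suc i} (s≤s p) = lookup-defined v p

imageBound : (ℕ → ℕ) → ℕ → ℕ
imageBound r zero    = 0
imageBound r (suc k) = imageBound r k ⊔ suc (r k)

imageBound-spec : ∀ r {i} B → i < B → r i < imageBound r B
imageBound-spec r (suc B) (s≤s i≤B) with m≤n⇒m<n∨m≡n i≤B
... | inj₁ i<B  = <-≤-trans (imageBound-spec r B i<B) (m≤m⊔n _ _)
... | inj₂ refl = <-≤-trans ≤-refl (m≤n⊔m (imageBound r B) _)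

renameAux : (r : ℕ ⤖ ℕ) (B : ℕ) {l : ℕ} → B ⊔ imageBound (Bijection.to r) B ≤ l →
  (v : Vec Bool l) → Σ (Vec Bool l) λ w →
    ∀ i → i < B → auxLookup w (Bijection.to r i) ≡ auxLookup v i
renameAux r B {l} long v = tabulateAux l (λ j → fromMaybe false (auxLookup v (from j))) , moved
  where
  to = Bijection.to r
  from : ℕ → ℕ
  from j = proj₁ (Bijection.strictlySurjective r j)
  from-to : ∀ i → from (to i) ≡ i
  from-to i = Bijection.injective r (proj₂ (Bijection.strictlySurjective r (to i)))
  moved : ∀ i → i < B → auxLookup (tabulateAux l (λ j → fromMaybe false (auxLookup v (from j)))) (to i)
                         ≡ auxLookup v i
  moved i i<B = begin
    auxLookup (tabulateAux l _) (to i)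
      ≡⟨ tabulateAux-lookup l _ (<-≤-trans (imageBound-spec to B i<B) (≤-trans (m≤n⊔m B _) long)) ⟩
    just (fromMaybe false (auxLookup v (from (to i))))
      ≡⟨ cong (λ k → just (fromMaybe false (auxLookup v k))) (from-to i) ⟩
    just (fromMaybe false (auxLookup v i))
      ≡⟨ sym (lookup-defined v (<-≤-trans i<B (≤-trans (m≤m⊔n B _) long))) ⟩
    auxLookup v i ∎
    where open ≡-Reasoning

module _ {n m : ℕ} where

  initial : ∀ {l} → Vec Bool n → Vec Bool l → Config {n} {m}
  initial b b' = inAuxFam b b' , outFam

  Related : IS n m → IS n m → ℕ → Set
  Related X Y l = (b' : Vec Bool l) → Σ (Vec Bool l) λ b'' → (b : Vec Bool n) →
    observe ⟨ X ⟩ (initial b b') ≈O observe ⟨ Y ⟩ (initial b b'')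

  related-trans : ∀ {X Y Z l} → Related X Y l → Related Y Z l → Related X Z l
  related-trans XY YZ b' =
    let (b'' , agree) = XY b' ; (b''' , agree') = YZ b'' in
    b''' , λ b → ≈O-trans (agree b) (agree' b)

  related-relabel : ∀ {l} r d (inj : ∀ {i j} → r i ≡ r j → i ≡ j) {X Y : IS n m} →
    ⟨ Y ⟩ ≡ Relabelling.relT r d ⟨ X ⟩ → (w : Vec Bool l → Vec Bool l) →
    (∀ b' i → i < auxBound ⟨ X ⟩ → auxLookup (w b') (r i) ≡ Maybe.map (d i xor_) (auxLookup b' i)) →
    Related X Y l
  related-relabel r d inj {X} e w translated b' = w b' , λ b →
    subst (λ t → observe ⟨ X ⟩ (initial b b') ≈O observe t (initial b (w b'))) (sym e)
          (relabel-sim ⟨ X ⟩ ≤-refl (initial b b') (initial b (w b')) (corr b , (λ _ → refl) , (λ _ → refl)))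
    where
    open Relabelling.Simulated r d inj (auxBound ⟨ X ⟩)
    corr : ∀ b g → focusBound g ≤ auxBound ⟨ X ⟩ →
      inAuxFam b (w b') (Relabelling.renF r d g) ≡ Maybe.map (Relabelling.flips r d g xor_) (inAuxFam b b' g)
    corr b (inF i)  _  = refl
    corr b (auxF i) bi = translated b' i bi
    corr b (outF j) _  = refl

  equivalent⇒related : ∀ {X Y : IS n m} → X ≃sa Y → ∃[ L ] (∀ l → L ≤ l → Related X Y l)
  equivalent⇒related {X} (sa-b e) = 0 , λ _ _ b' → b' , λ b →
    subst (λ t → observe ⟨ X ⟩ (initial b b') ≈O observe t (initial b b')) e ≈O-refl
  equivalent⇒related (sa-t p) = 0 , λ _ _ b' → b' , λ b → observe-≈t p _ _ ≐₂-refl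
  equivalent⇒related {X} (sa-x I refl) = 0 , λ _ _ →
    related-relabel (λ i → i) d (λ e → e) {X} {χ I X} (extract-relabel (chiInstr I) (chi-relabel I) X)
                    (invertAux d) (λ b' i _ → invertAux-lookup d b' i)
    where d = λ i → memb i I
          open Relabelling (λ i → i) d using (extract-relabel)
  equivalent⇒related {X} (sa-r r refl) = B ⊔ imageBound to B , λ l long →
    related-relabel to (λ _ → false) (Bijection.injective r) {X} {ρ r X}
                    (extract-relabel (renInstr to) (ren-relabel to) X)
                    (λ v → proj₁ (renameAux r B long v))
                    (λ b' i i<B → trans (proj₂ (renameAux r B long b') i i<B) (sym (map-id _)))
    where to = Bijection.to r
          B = auxBound ⟨ X ⟩
          open Relabelling to (λ _ → false) using (extract-relabel)
  equivalent⇒related {X} {Z} (sa-trans {Y = Y} p q) with equivalent⇒related p | equivalent⇒related q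
  ... | L₁ , related₁ | L₂ , related₂ = L₁ ⊔ L₂ , λ l long →
    related-trans {X} {Y} {Z} (related₁ l (≤-trans (m≤m⊔n L₁ L₂) long)) (related₂ l (≤-trans (m≤n⊔m L₁ L₂) long))

theorem1 : (n m : ℕ) (X Y : IS n m) → X ≃sa Y →
    ∃[ l ] ((b' : Vec Bool l) → Σ (Vec Bool l) λ b'' → ((b : Vec Bool n) →
      (((⟨ X ⟩ / inAuxFam b b') • outFam) ≐ ((⟨ Y ⟩ / inAuxFam b b'') • outFam))
      × (depth ((⟨ X ⟩ // inAuxFam b b') // outFam)
         ≡ depth ((⟨ Y ⟩ // inAuxFam b b'') // outFam))))
theorem1 n m X Y X≃Y with equivalent⇒related X≃Y
... | L , related = L , λ b' →
  let (b'' , agree) = related L ≤-refl b' in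
  b'' , λ b → adequacy ⟨ X ⟩ ⟨ Y ⟩ (agree b)
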